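{- Let $\mathbf{P}=\langle P,\le,\cdot,1\rangle$ be a partially ordered monoid and let $\mathbf{L}$ be a join-extension of the poset $\langle P,\le\rangle$ which is also a partially ordered monoid with respect to a multiplication extending the multiplication of $\mathbf{P}$. Let $a,b\in P$ and suppose that the left residual $a\backslash_{\mathbf{P}} b$ exists in $\mathbf{P}$. Then $a\backslash_{\mathbf{L}} b$ exists in $\mathbf{L}$, $a\backslash_{\mathbf{L}} b=a\backslash_{\mathbf{P}} b$, and moreover ${\downarrow}(a\backslash_{\mathbf{P}} b)={\downarrow}a\backslash_{\mathcal{L}(\mathbf{P})}{\downarrow}b={\downarrow}a\backslash_{\wp(\mathbf{P})}{\downarrow}b$. The analogous statements hold for the right residual $b/a$.
   Context: A partially ordered monoid (pomonoid) is a monoid $\langle P,\cdot,1\rangle$ with a partial order $\le$ such that multiplication is order-preserving in each argument. In a pomonoid $\mathbf{Q}$, the left and right residuals of $b$ by $a$, when they exist, are $a\backslash_{\mathbf{Q}} b=\max\{x\in Q\mid ax\le b\}$ and $b/_{\mathbf{Q}} a=\max\{x\in Q\mid xa\le b\}$. A poset $\mathbf{L}$ is a join-extension of a poset $\mathbf{P}$ if $P\subseteq L$, the order of $\mathbf{L}$ restricts to that of $\mathbf{P}$, and every element of $L$ is a join in $\mathbf{L}$ of a subset of $P$. $\wp(\mathbf{P})$ is the set of all subsets of $P$ with $X\cdot Y=\{xy\mid x\in X,y\in Y\}$, $X\backslash Y=\{z\in P\mid xz\in Y\ \forall x\in X\}$, $Y/X=\{z\in P\mid zx\in Y\ \forall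 x\in X\}$; $\mathcal{L}(\mathbf{P})$ is the set of order-ideals (down-sets) of $\mathbf{P}$, a residuated lattice under $\cap,\cup$, product $X\circ Y={\downarrow}(X\cdot Y)$, and the same residuals as in $\wp(\mathbf{P})$ (which are again order-ideals), with unit ${\downarrow}1$. Here ${\downarrow}x=\{p\in P\mid p\le x\}$. -}

module Defs where

open import Level using (Level; _⊔_; suc)
open import Data.Product using (Σ; _×_; _,_)
open import Function.Bundles using (_⇔_)
open import Relation.Unary using (Pred)
open import Relation.Binary.Core using (Rel)
open import Relation.Binary.Structures using (IsPartialOrder)
open import Algebra.Core using (Op₂)
open import Algebra.Structures using (IsMonoid)

record Pomonoid (c ℓ₁ ℓ₂ : Level) : Set (suc (c ⊔ ℓ₁ ⊔ ℓ₂)) where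
  infixl 7 _∙_
  infix 4 _≈_ _≤_
  field
    Carrier        : Set c
    _≈_            : Rel Carrier ℓ₁
    _≤_            : Rel Carrier ℓ₂
    _∙_            : Op₂ Carrier
    ε              : Carrier
    isPartialOrder : IsPartialOrder _≈_ _≤_
    isMonoid       : IsMonoid _≈_ _∙_ ε
    ∙-monoˡ        : ∀ {x y} z → x ≤ y → x ∙ z ≤ y ∙ z
    ∙-monoʳ        : ∀ {x y} z → x ≤ y → z ∙ x ≤ z ∙ y

module _ {c ℓ₁ ℓ₂} (Q : Pomonoid c ℓ₁ ℓ₂) where
  open Pomonoid Q

  IsLeftResidual : Carrier → Carrier → Carrier → Set (c ⊔ ℓ₂)
  IsLeftResidual a b r = (a ∙ r ≤ b) × (∀ x → a ∙ x ≤ b → x ≤ r)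

  IsRightResidual : Carrier → Carrier → Carrier → Set (c ⊔ ℓ₂)
  IsRightResidual a b r = (r ∙ a ≤ b) × (∀ x → x ∙ a ≤ b → x ≤ r)

  ↓_ : Carrier → Pred Carrier ℓ₂
  (↓ x) p = p ≤ x

  ℘-leftRes : ∀ {s t} → Pred Carrier s → Pred Carrier t → Pred Carrier (c ⊔ s ⊔ t)
  ℘-leftRes X Y z = ∀ x → X x → Y (x ∙ z)

  ℘-rightRes : ∀ {s t} → Pred Carrier t → Pred Carrier s → Pred Carrier (c ⊔ s ⊔ t)
  ℘-rightRes Y X z = ∀ x → X x → Y (z ∙ x)

  -- residuals in 𝓛(P) (order ideals); by definition the same formulas as in ℘(P)
  ℒ-leftRes : ∀ {s t} → Pred Carrier s → Pred Carrier t → Pred Carrier (c ⊔ s ⊔ t)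
  ℒ-leftRes X Y z = ∀ x → X x → Y (x ∙ z)

  ℒ-rightRes : ∀ {s t} → Pred Carrier t → Pred Carrier s → Pred Carrier (c ⊔ s ⊔ t)
  ℒ-rightRes Y X z = ∀ x → X x → Y (z ∙ x)

-- L is a join-extension of the poset of P, and a pomonoid whose multiplication
-- extends that of P. P ⊆ L is modelled by an order embedding `emb`.
record JoinExtension {c ℓ₁ ℓ₂ c' ℓ₁' ℓ₂'} (s : Level)
         (P : Pomonoid c ℓ₁ ℓ₂) (L : Pomonoid c' ℓ₁' ℓ₂')
         : Set (c ⊔ ℓ₂ ⊔ c' ⊔ ℓ₁' ⊔ ℓ₂' ⊔ suc s) where
  private
    module P = Pomonoid P
    module L = Pomonoid L
  field
    emb       : P.Carrier → L.Carrier
    emb-order : ∀ x y → (x P.≤ y) ⇔ (emb x L.≤ emb y)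
    emb-mult  : ∀ x y → emb (x P.∙ y) L.≈ (emb x L.∙ emb y)
    joinDense : ∀ l → Σ (Pred P.Carrier s) λ S →
                  (∀ p → S p → emb p L.≤ l) ×
                  (∀ u → (∀ p → S p → emb p L.≤ u) → l L.≤ u)

module Submission where

open import Defs
open import Level using (Level)
open import Data.Product using (_×_; _,_)
open import Function.Base using (flip)
open import Function.Bundles using (_⇔_; mk⇔; Equivalence)
open import Function.Construct.Identity using (⇔-id)
open import Relation.Binary.Structures using (IsPartialOrder)
import Algebra.Construct.Flip.Op as Flip

-- Every element of L is a join of elements of P, so a ∙ x ≤ b in L is tested on
-- the elements of P below x, where it becomes a ∙ p ≤ b in P.  The down-set
-- statements only need monotonicity of ∙, and the right-residual half is the
-- left-residual half for the opposite multiplication.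

private
  variable
    c ℓ₁ ℓ₂ c' ℓ₁' ℓ₂' s : Level

_ᵒᵖ : Pomonoid c ℓ₁ ℓ₂ → Pomonoid c ℓ₁ ℓ₂
P ᵒᵖ = record
  { Carrier        = Carrier
  ; _≈_            = _≈_
  ; _≤_            = _≤_
  ; _∙_            = flip _∙_
  ; ε              = ε
  ; isPartialOrder = isPartialOrder
  ; isMonoid       = Flip.isMonoid isMonoid
  ; ∙-monoˡ        = ∙-monoʳ
  ; ∙-monoʳ        = ∙-monoˡ
  }
  where open Pomonoid P

JoinExtensionᵒᵖ : {P : Pomonoid c ℓ₁ ℓ₂} {L : Pomonoid c' ℓ₁' ℓ₂'} →
                  JoinExtension s P L → JoinExtension s (P ᵒᵖ) (L ᵒᵖ)
JoinExtensionᵒᵖ E = record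
  { emb       = emb
  ; emb-order = emb-order
  ; emb-mult  = λ x y → emb-mult y x
  ; joinDense = joinDense
  }
  where open JoinExtension E

module _ (P : Pomonoid c ℓ₁ ℓ₂) where
  open Pomonoid P
  open IsPartialOrder isPartialOrder using (refl; trans)

  ↓-leftResidual : ∀ {a b r} → IsLeftResidual P a b r →
                   ∀ z → (↓_ P r) z ⇔ ℒ-leftRes P (↓_ P a) (↓_ P b) z
  ↓-leftResidual {a} {b} {r} (ar≤b , r-max) z = mk⇔ below-residual⇒ideal ideal⇒below-residual
    where
    below-residual⇒ideal : z ≤ r → ∀ x → x ≤ a → x ∙ z ≤ b
    below-residual⇒ideal z≤r x x≤a = trans (∙-monoˡ z x≤a) (trans (∙-monoʳ a z≤r) ar≤b)

    ideal⇒below-residual : (∀ x → x ≤ a → x ∙ z ≤ b) → z ≤ r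
    ideal⇒below-residual az≤b = r-max z (az≤b a refl)

module _ {P : Pomonoid c ℓ₁ ℓ₂} {L : Pomonoid c' ℓ₁' ℓ₂'} (E : JoinExtension s P L) where
  private
    module P = Pomonoid P
    module L = Pomonoid L
    module ≤L = IsPartialOrder L.isPartialOrder
  open JoinExtension E

  emb-mono : ∀ {x y} → x P.≤ y → emb x L.≤ emb y
  emb-mono {x} {y} = Equivalence.to (emb-order x y)

  emb-reflect : ∀ {x y} → emb x L.≤ emb y → x P.≤ y
  emb-reflect {x} {y} = Equivalence.from (emb-order x y)

  emb-∙-≤⇔ : ∀ x y z → (x P.∙ y P.≤ z) ⇔ (emb x L.∙ emb y L.≤ emb z)
  emb-∙-≤⇔ x y z = mk⇔
    (λ xy≤z → ≤L.trans (≤L.reflexive (≤L.Eq.sym (emb-mult x y))) (emb-mono xy≤z))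
    (λ xy≤z → emb-reflect (≤L.trans (≤L.reflexive (emb-mult x y)) xy≤z))

  ≤-fromBelow : ∀ l u → (∀ p → emb p L.≤ l → emb p L.≤ u) → l L.≤ u
  ≤-fromBelow l u below⇒≤u with joinDense l
  ... | S , S≤l , l-least = l-least u λ p p∈S → below⇒≤u p (S≤l p p∈S)

  emb-leftResidual : ∀ {a b r} → IsLeftResidual P a b r →
                     IsLeftResidual L (emb a) (emb b) (emb r)
  emb-leftResidual {a} {b} {r} (ar≤b , r-max) =
    Equivalence.to (emb-∙-≤⇔ a r b) ar≤b , emb-r-max
    where
    emb-r-max : ∀ x → emb a L.∙ x L.≤ emb b → x L.≤ emb r
    emb-r-max x ax≤b = ≤-fromBelow x (emb r) λ p p≤x →
      emb-mono (r-max p (Equivalence.from (emb-∙-≤⇔ a p b)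
                          (≤L.trans (L.∙-monoʳ (emb a) p≤x) ax≤b)))

leftResidual-lifts : {P : Pomonoid c ℓ₁ ℓ₂} {L : Pomonoid c' ℓ₁' ℓ₂'} (E : JoinExtension s P L)
                     (a b r : Pomonoid.Carrier P) → IsLeftResidual P a b r →
  IsLeftResidual L (JoinExtension.emb E a) (JoinExtension.emb E b) (JoinExtension.emb E r)
  × (∀ z → (↓_ P r) z ⇔ ℒ-leftRes P (↓_ P a) (↓_ P b) z)
  × (∀ z → ℒ-leftRes P (↓_ P a) (↓_ P b) z ⇔ ℘-leftRes P (↓_ P a) (↓_ P b) z)
leftResidual-lifts {P = P} E a b r res =
  emb-leftResidual E res , ↓-leftResidual P res , λ _ → ⇔-id _

lemma3p4 : ∀ {c ℓ₁ ℓ₂ c' ℓ₁' ℓ₂' s : Level}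
    (P : Pomonoid c ℓ₁ ℓ₂) (L : Pomonoid c' ℓ₁' ℓ₂') (E : JoinExtension s P L)
    (a b : Pomonoid.Carrier P) →
    (∀ r → IsLeftResidual P a b r →
      IsLeftResidual L (JoinExtension.emb E a) (JoinExtension.emb E b) (JoinExtension.emb E r)
      × (∀ z → (↓_ P r) z ⇔ ℒ-leftRes P (↓_ P a) (↓_ P b) z)
      × (∀ z → ℒ-leftRes P (↓_ P a) (↓_ P b) z ⇔ ℘-leftRes P (↓_ P a) (↓_ P b) z))
    ×
    (∀ r → IsRightResidual P a b r →
      IsRightResidual L (JoinExtension.emb E a) (JoinExtension.emb E b) (JoinExtension.emb E r)
      × (∀ z → (↓_ P r) z ⇔ ℒ-rightRes P (↓_ P b) (↓_ P a) z)
      × (∀ z → ℒ-rightRes P (↓_ P b) (↓_ P a) z ⇔ ℘-rightRes P (↓_ P b) (↓_ P a) z))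
lemma3p4 P L E a b =
  leftResidual-lifts E a b , leftResidual-lifts (JoinExtensionᵒᵖ E) a b
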